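{- Let $N,t$ be positive integers with $t\mid N$, and let $T(N,t)$ be the complete $t$-partite graph on $N$ vertices with parts $P_1,\ldots,P_t$ each of size $N/t$. Given a FAT coloring of $T(N,t)$ and two distinct parts $P_g$ and $P_s$, the part $P_g$ is monochromatic (all its vertices have the same color) if and only if $P_s$ is monochromatic.
   Context: For $v\in V$ and $S\subseteq V$, let $e(v,S)$ denote the number of neighbors of $v$ in $S$. A vertex $k$-coloring is a function $c:V\to\{1,\ldots,k\}$ with coloring classes $V_i=c^{ -1}(i)$. It is Fair and Tolerant (FAT) if there exists $\alpha\in[0,1]$ such that, with $\beta:=1-(k-1)\alpha$, for every vertex $v$ and every $i$ we have $e(v,V_i)=\alpha\deg v$ if $v\notin V_i$ and $e(v,V_i)=\beta\deg v$ if $v\in V_i$. -}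

module Defs where

open import Data.Nat using (ℕ; zero; suc; _/_; NonZero; _∸_; _*_)
open import Data.Nat.Properties using (_≟_)
open import Data.Fin using (Fin; toℕ)
open import Data.Fin.Properties using () renaming (_≟_ to _≟ᶠ_)
open import Data.List using (List; length; filter)
open import Data.List using () renaming (allFin to allFinL)
open import Data.Product using (∃; _×_; _,_)
open import Data.Bool using (Bool; true; false; _∧_; not)
open import Relation.Nullary using (¬_; Dec; yes; no)
open import Relation.Nullary.Decidable using (⌊_⌋; _×-dec_; ¬?)
open import Relation.Binary.PropositionalEquality using (_≡_; _≢_)
open import Data.Integer using (+_)
open import Data.Rational using (ℚ; _≤_; _-_; 0ℚ; 1ℚ) renaming (_*_ to _*ℚ_; _/_ to _/ℚ_)

record Graph (n : ℕ) : Set₁ where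
  field
    Adj      : Fin n → Fin n → Set
    adj?     : (u v : Fin n) → Dec (Adj u v)
    sym      : ∀ {u v} → Adj u v → Adj v u
    irrefl   : ∀ {u} → ¬ Adj u u

open Graph public

ℕ→ℚ : ℕ → ℚ
ℕ→ℚ k = (+ k) /ℚ 1

deg : ∀ {n} → Graph n → Fin n → ℕ
deg G v = length (filter (λ u → adj? G v u) (allFinL _))

eCol : ∀ {n k} → Graph n → (Fin n → Fin k) → Fin n → Fin k → ℕ
eCol G c v i = length (filter (λ u → adj? G v u ×-dec (c u ≟ᶠ i)) (allFinL _))

FAT : ∀ {n} (k : ℕ) → Graph n → (Fin n → Fin k) → Set
FAT {n} k G c =
  ∃ λ (α : ℚ) → (0ℚ ≤ α) × (α ≤ 1ℚ) ×
    (∀ (v : Fin n) (i : Fin k) →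
        (c v ≢ i → ℕ→ℚ (eCol G c v i) ≡ α *ℚ ℕ→ℚ (deg G v)) ×
        (c v ≡ i → ℕ→ℚ (eCol G c v i) ≡ (1ℚ - ℕ→ℚ (k ∸ 1) *ℚ α) *ℚ ℕ→ℚ (deg G v)))

-- Vertices are Fin (t * m); vertex v lies in part ⌊v / m⌋ ∈ {0,…,t-1}
-- (part P_{p+1} of the paper is the part with index p).
partOf : (t m : ℕ) .{{_ : NonZero m}} → Fin (t * m) → ℕ
partOf t m v = toℕ v / m

T : (t m : ℕ) .{{_ : NonZero m}} → Graph (t * m)
T t m = record
  { Adj    = λ u v → partOf t m u ≢ partOf t m v
  ; adj?   = λ u v → ¬? (partOf t m u ≟ partOf t m v)
  ; sym    = λ p q → p (Relation.Binary.PropositionalEquality.sym q)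
  ; irrefl = λ p → p Relation.Binary.PropositionalEquality.refl
  }

Monochromatic : ∀ {k} (t m : ℕ) .{{_ : NonZero m}} → (Fin (t * m) → Fin k) → ℕ → Set
Monochromatic t m c p =
  ∀ (u v : Fin (t * m)) → partOf t m u ≡ p → partOf t m v ≡ p → c u ≡ c v

{-# OPTIONS --safe #-}
module Submission where

-- In T(N, t) all vertices have the same degree and vertices in one part have the same neighbourhood.
-- If some part contains vertices u, w with colours i = c u ≠ c w, then e(u, V_i) = β·deg and
-- e(w, V_i) = α·deg are equal, so α = β and every vertex sees every colour class equally often.
-- As |V_a| = e(v, V_a) + |V_a ∩ part(v)|, every part then meets V_a in equally many vertices; so if
-- one part is entirely of colour a, every part is, contradicting the two-coloured part.
-- Hence one monochromatic part forces all parts to be monochromatic.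

open import Defs hiding (sym)

open import Data.Fin using (Fin; toℕ; fromℕ<) renaming (_≟_ to _≟ᶠ_)
open import Data.Fin.Properties using (toℕ<n; toℕ-fromℕ<)
open import Data.List using (List; []; _∷_; _++_; length; filter; map; tabulate; applyUpTo; upTo; allFin)
open import Data.List.Membership.Propositional using (_∈_)
open import Data.List.Membership.Propositional.Properties using (∈-allFin; ∈-filter⁺; ∈-filter⁻)
open import Data.List.Properties
  using (length-++; length-applyUpTo; length-tabulate; map-tabulate; filter-++; filter-all; filter-none;
         filter-complete; filter-≐; ++-assoc)
open import Data.List.Relation.Unary.All using (All)
open import Data.List.Relation.Unary.All.Properties using (applyUpTo⁺₁; applyUpTo⁺₂)
open import Data.Nat using (ℕ; zero; suc; _+_; _*_; _∸_; _/_; _<_; NonZero)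
open import Data.Nat.DivMod using (m*n/n≡m; m<n⇒m/n≡0; +-distrib-/-∣ˡ; m<n*o⇒m/o<n)
open import Data.Nat.Divisibility using (n∣m*n)
open import Data.Nat.Properties
  using (_≟_; +-suc; +-comm; +-identityʳ; +-cancelˡ-≡; *-cancelʳ-≡; *-distribʳ-+; *-monoˡ-<;
         m+[n∸m]≡n; m+n∸n≡m; <⇒≢; >⇒≢; m≤m+n)
open import Data.Product using (Σ; _,_; proj₁; proj₂; map₁)
open import Data.Rational using (ℚ; 1ℚ; _-_) renaming (_*_ to _*ℚ_)
open import Data.Rational.Properties using (normalize-injective-≃)
open import Data.Sum using ([_,_]′)
open import Function using (_∘_; id)
open import Function.Bundles using (_⇔_; mk⇔)
open import Relation.Binary.PropositionalEquality
  using (_≡_; _≢_; refl; sym; trans; cong; cong₂; subst; module ≡-Reasoning)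
open import Relation.Nullary using (¬_; yes; no)
open import Relation.Nullary.Decidable using (decidable-stable; toSum)
open import Relation.Unary using (Pred; Decidable)
open import Relation.Unary.Properties using (∁?; _∩?_)

count : ∀ {a p} {A : Set a} {P : Pred A p} → Decidable P → List A → ℕ
count P? xs = length (filter P? xs)

module _ {a p} {A : Set a} {P : Pred A p} (P? : Decidable P) where

  count-++ : ∀ xs ys → count P? (xs ++ ys) ≡ count P? xs + count P? ys
  count-++ xs ys = trans (cong length (filter-++ P? xs ys)) (length-++ (filter P? xs))

  count-map : ∀ {b} {B : Set b} (f : B → A) xs → count (P? ∘ f) xs ≡ count P? (map f xs)
  count-map f [] = refl
  count-map f (x ∷ xs) with P? (f x)
  ... | yes _ = cong suc (count-map f xs)
  ... | no _  = count-map f xs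

  count-∁+count : ∀ xs → count (∁? P?) xs + count P? xs ≡ length xs
  count-∁+count [] = refl
  count-∁+count (x ∷ xs) with P? x
  ... | yes _ = trans (+-suc _ _) (cong suc (count-∁+count xs))
  ... | no _  = cong suc (count-∁+count xs)

module _ {a p q} {A : Set a} {P : Pred A p} {Q : Pred A q} (P? : Decidable P) (Q? : Decidable Q) where

  count-∁∩+count-∩ : ∀ xs → count (∁? P? ∩? Q?) xs + count (P? ∩? Q?) xs ≡ count Q? xs
  count-∁∩+count-∩ [] = refl
  count-∁∩+count-∩ (x ∷ xs) with P? x | Q? x
  ... | yes _ | yes _ = trans (+-suc _ _) (cong suc (count-∁∩+count-∩ xs))
  ... | yes _ | no _  = count-∁∩+count-∩ xs
  ... | no _  | yes _ = cong suc (count-∁∩+count-∩ xs)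
  ... | no _  | no _  = count-∁∩+count-∩ xs

  filter-∩ : ∀ xs → filter (P? ∩? Q?) xs ≡ filter Q? (filter P? xs)
  filter-∩ [] = refl
  filter-∩ (x ∷ xs) with P? x
  ... | no _  = filter-∩ xs
  ... | yes _ with Q? x
  ...   | yes _ = cong (x ∷_) (filter-∩ xs)
  ...   | no _  = filter-∩ xs

  count-∩≡count⇒⊆ : ∀ xs → count (P? ∩? Q?) xs ≡ count P? xs → ∀ {y} → y ∈ xs → P y → Q y
  count-∩≡count⇒⊆ xs eq {y} y∈xs Py =
    proj₂ (∈-filter⁻ Q? {xs = filter P? xs} (subst (y ∈_) (sym Q-all) (∈-filter⁺ P? y∈xs Py)))
    where
    Q-all : filter Q? (filter P? xs) ≡ filter P? xs
    Q-all = filter-complete Q? (trans (cong length (sym (filter-∩ xs))) eq)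

tabulate-∘toℕ : ∀ {a} {A : Set a} (f : ℕ → A) n → tabulate {n = n} (f ∘ toℕ) ≡ applyUpTo f n
tabulate-∘toℕ f zero    = refl
tabulate-∘toℕ f (suc n) = cong (f 0 ∷_) (tabulate-∘toℕ (f ∘ suc) n)

map-toℕ-allFin : ∀ n → map toℕ (allFin n) ≡ upTo n
map-toℕ-allFin n = trans (map-tabulate id toℕ) (tabulate-∘toℕ id n)

count-allFin : ∀ {p} {P : Pred ℕ p} (P? : Decidable P) n → count (P? ∘ toℕ) (allFin n) ≡ count P? (upTo n)
count-allFin P? n = trans (count-map P? toℕ (allFin n)) (cong (count P?) (map-toℕ-allFin n))

applyUpTo-+ : ∀ {a} {A : Set a} (f : ℕ → A) m n → applyUpTo f (m + n) ≡ applyUpTo f m ++ applyUpTo (f ∘ (m +_)) n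
applyUpTo-+ f zero    n = refl
applyUpTo-+ f (suc m) n = cong (f 0 ∷_) (applyUpTo-+ (f ∘ suc) m n)

[m*n+o]/n≡m+o/n : ∀ m n o .{{_ : NonZero n}} → (m * n + o) / n ≡ m + o / n
[m*n+o]/n≡m+o/n m n o = trans (+-distrib-/-∣ˡ o (n∣m*n m)) (cong (_+ o / n) (m*n/n≡m m n))

upTo-*-split : ∀ {p q} M → p < q →
  upTo (q * M) ≡ upTo (p * M) ++ applyUpTo (p * M +_) M ++ applyUpTo (suc p * M +_) ((q ∸ suc p) * M)
upTo-*-split {p} {q} M p<q = begin
  upTo (q * M)                                               ≡⟨ cong (λ n → upTo (n * M)) (sym (m+[n∸m]≡n p<q)) ⟩
  upTo ((suc p + r) * M)                                     ≡⟨ cong upTo (*-distribʳ-+ M (suc p) r) ⟩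
  upTo (suc p * M + r * M)                                   ≡⟨ applyUpTo-+ id (suc p * M) (r * M) ⟩
  upTo (M + p * M) ++ high                                   ≡⟨ cong (λ n → upTo n ++ high) (+-comm M (p * M)) ⟩
  upTo (p * M + M) ++ high                                   ≡⟨ cong (_++ high) (applyUpTo-+ id (p * M) M) ⟩
  (upTo (p * M) ++ applyUpTo (p * M +_) M) ++ high           ≡⟨ ++-assoc (upTo (p * M)) _ high ⟩
  upTo (p * M) ++ applyUpTo (p * M +_) M ++ high             ∎
  where
  open ≡-Reasoning
  r : ℕ
  r = q ∸ suc p
  high : List ℕ
  high = applyUpTo (suc p * M +_) (r * M)

count-quotient : ∀ {p q} M .{{_ : NonZero M}} → p < q → count (λ i → p ≟ i / M) (upTo (q * M)) ≡ M
count-quotient {p} {q} M p<q = begin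
  count R? (upTo (q * M))                            ≡⟨ cong (count R?) (upTo-*-split M p<q) ⟩
  count R? (below ++ block ++ above)                 ≡⟨ count-++ R? below (block ++ above) ⟩
  count R? below + count R? (block ++ above)         ≡⟨ cong (count R? below +_) (count-++ R? block above) ⟩
  count R? below + (count R? block + count R? above) ≡⟨ cong₂ _+_ none-below (cong₂ _+_ all-block none-above) ⟩
  0 + (M + 0)                                        ≡⟨ +-identityʳ M ⟩
  M                                                  ∎
  where
  open ≡-Reasoning
  R? : Decidable (λ i → p ≡ i / M)
  R? i = p ≟ i / M
  below block above : List ℕ
  below = upTo (p * M)
  block = applyUpTo (p * M +_) M
  above = applyUpTo (suc p * M +_) ((q ∸ suc p) * M)
  none-below : count R? below ≡ 0
  none-below = cong length (filter-none R? (applyUpTo⁺₁ id (p * M) λ i<pM → >⇒≢ (m<n*o⇒m/o<n i<pM)))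
  all-block : count R? block ≡ M
  all-block = trans (cong length (filter-all R? (applyUpTo⁺₁ (p * M +_) M λ {i} i<M →
      sym (trans ([m*n+o]/n≡m+o/n p M i) (trans (cong (p +_) (m<n⇒m/n≡0 i<M)) (+-identityʳ p))))))
    (length-applyUpTo (p * M +_) M)
  none-above : count R? above ≡ 0
  none-above = cong length (filter-none R? (applyUpTo⁺₂ (suc p * M +_) ((q ∸ suc p) * M) λ j →
    <⇒≢ (subst (p <_) (sym ([m*n+o]/n≡m+o/n (suc p) M j)) (m≤m+n (suc p) (j / M)))))

-- ℕ→ℚ m unfolds to normalize m 1.
ℕ→ℚ-injective : ∀ m n → ℕ→ℚ m ≡ ℕ→ℚ n → m ≡ n
ℕ→ℚ-injective m n eq = *-cancelʳ-≡ m n 1 (normalize-injective-≃ m n 1 1 eq)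

module CompleteMultipartite (q M : ℕ) .{{_ : NonZero M}} where

  N : ℕ
  N = q * M

  G : Graph N
  G = T q M

  part : Fin N → ℕ
  part = partOf q M

  part-inhabited : ∀ {p} → p < q → Σ (Fin N) λ v → part v ≡ p
  part-inhabited {p} p<q = fromℕ< pM<N , trans (cong (_/ M) (toℕ-fromℕ< pM<N)) (m*n/n≡m p M)
    where
    pM<N : p * M < N
    pM<N = *-monoˡ-< M p<q

  samePart? : (v : Fin N) → Decidable (λ u → part v ≡ part u)
  samePart? v u = part v ≟ part u

  partSize : ∀ v → count (samePart? v) (allFin N) ≡ M
  partSize v = trans (count-allFin (λ i → part v ≟ i / M) N) (count-quotient {q = q} M (m<n*o⇒m/o<n (toℕ<n v)))

  deg≡N∸M : ∀ v → deg G v ≡ N ∸ M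
  deg≡N∸M v = begin
    deg G v                     ≡⟨ m+n∸n≡m (deg G v) M ⟨
    deg G v + M ∸ M             ≡⟨ cong (λ n → deg G v + n ∸ M) (partSize v) ⟨
    count (∁? (samePart? v)) (allFin N) + count (samePart? v) (allFin N) ∸ M
                                ≡⟨ cong (_∸ M) (count-∁+count (samePart? v) (allFin N)) ⟩
    length (allFin N) ∸ M       ≡⟨ cong (_∸ M) (length-tabulate id) ⟩
    N ∸ M                       ∎
    where open ≡-Reasoning

  module _ {k} (c : Fin N → Fin k) where

    hasColour? : (i : Fin k) → Decidable (λ u → c u ≡ i)
    hasColour? i u = c u ≟ᶠ i

    partColourCount : Fin N → Fin k → ℕ
    partColourCount v i = count (samePart? v ∩? hasColour? i) (allFin N)

    eCol-samePart : ∀ {u w} i → part u ≡ part w → eCol G c u i ≡ eCol G c w i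
    eCol-samePart {u} {w} i pu≡pw = cong length (filter-≐ (∁? (samePart? u) ∩? hasColour? i)
      (∁? (samePart? w) ∩? hasColour? i) (map₁ (_∘ trans pu≡pw) , map₁ (_∘ trans (sym pu≡pw))) (allFin N))

    eCol+partColourCount : ∀ v i → eCol G c v i + partColourCount v i ≡ count (hasColour? i) (allFin N)
    eCol+partColourCount v i = count-∁∩+count-∩ (samePart? v) (hasColour? i) (allFin N)

    full-part⇒coloured : ∀ {v i} → partColourCount v i ≡ M → ∀ {u} → part v ≡ part u → c u ≡ i
    full-part⇒coloured {v} {i} full {u} =
      count-∩≡count⇒⊆ (samePart? v) (hasColour? i) (allFin N) (trans full (sym (partSize v))) (∈-allFin u)

    monochromatic⇒full-part : ∀ v → Monochromatic q M c (part v) → partColourCount v (c v) ≡ M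
    monochromatic⇒full-part v mono = trans (cong length (filter-≐ (samePart? v ∩? hasColour? (c v)) (samePart? v)
      (proj₁ , λ {u} pv≡pu → pv≡pu , mono u v (sym pv≡pu) refl) (allFin N))) (partSize v)

    full-part-spreads : ∀ {i} → (∀ x y → eCol G c x i ≡ eCol G c y i) →
                        ∀ {v} → partColourCount v i ≡ M → ∀ w → partColourCount w i ≡ M
    full-part-spreads {i} uniform {v} full w = +-cancelˡ-≡ (eCol G c w i) _ _ (begin
      eCol G c w i + partColourCount w i   ≡⟨ eCol+partColourCount w i ⟩
      count (hasColour? i) (allFin N)      ≡⟨ eCol+partColourCount v i ⟨
      eCol G c v i + partColourCount v i   ≡⟨ cong₂ _+_ (uniform v w) full ⟩
      eCol G c w i + M                     ∎)
      where open ≡-Reasoning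

  module _ {k} {c : Fin N → Fin k} (fat : FAT k G c) where

    α β d : ℚ
    α = proj₁ fat
    β = 1ℚ - ℕ→ℚ (k ∸ 1) *ℚ α
    d = ℕ→ℚ (N ∸ M)

    eCol-otherColour : ∀ {v i} → c v ≢ i → ℕ→ℚ (eCol G c v i) ≡ α *ℚ d
    eCol-otherColour {v} {i} cv≢i =
      trans (proj₁ (proj₂ (proj₂ (proj₂ fat)) v i) cv≢i) (cong (λ n → α *ℚ ℕ→ℚ n) (deg≡N∸M v))

    eCol-ownColour : ∀ {v i} → c v ≡ i → ℕ→ℚ (eCol G c v i) ≡ β *ℚ d
    eCol-ownColour {v} {i} cv≡i =
      trans (proj₂ (proj₂ (proj₂ (proj₂ fat)) v i) cv≡i) (cong (λ n → β *ℚ ℕ→ℚ n) (deg≡N∸M v))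

    twoColouredPart⇒α≡β : ∀ {u w} → part u ≡ part w → c u ≢ c w → α *ℚ d ≡ β *ℚ d
    twoColouredPart⇒α≡β {u} {w} pu≡pw cu≢cw = begin
      α *ℚ d                    ≡⟨ eCol-otherColour (cu≢cw ∘ sym) ⟨
      ℕ→ℚ (eCol G c w (c u))    ≡⟨ cong ℕ→ℚ (eCol-samePart c (c u) pu≡pw) ⟨
      ℕ→ℚ (eCol G c u (c u))    ≡⟨ eCol-ownColour refl ⟩
      β *ℚ d                    ∎
      where open ≡-Reasoning

    α≡β⇒uniform-eCol : α *ℚ d ≡ β *ℚ d → ∀ {i} x y → eCol G c x i ≡ eCol G c y i
    α≡β⇒uniform-eCol α≡β {i} x y = ℕ→ℚ-injective (eCol G c x i) (eCol G c y i) (trans (sees x) (sym (sees y)))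
      where
      sees : ∀ x → ℕ→ℚ (eCol G c x i) ≡ β *ℚ d
      sees x = [ eCol-ownColour , (λ cx≢i → trans (eCol-otherColour cx≢i) α≡β) ]′ (toSum (c x ≟ᶠ i))

    twoColouredPart⇒¬monochromatic : ∀ {u w g} → part u ≡ part w → c u ≢ c w → g < q → ¬ Monochromatic q M c g
    twoColouredPart⇒¬monochromatic {u} {w} pu≡pw cu≢cw g<q mono =
      cu≢cw (trans (coloured-cv refl) (sym (coloured-cv pu≡pw)))
      where
      v : Fin N
      v = proj₁ (part-inhabited g<q)
      coloured-cv : ∀ {x} → part u ≡ part x → c x ≡ c v
      coloured-cv = full-part⇒coloured c
        (full-part-spreads c (α≡β⇒uniform-eCol (twoColouredPart⇒α≡β pu≡pw cu≢cw))
          (monochromatic⇒full-part c v (subst (Monochromatic q M c) (sym (proj₂ (part-inhabited g<q))) mono)) u)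

    monochromatic-spreads : ∀ {g s} → g < q → Monochromatic q M c g → Monochromatic q M c s
    monochromatic-spreads g<q mono u w pu pw = decidable-stable (c u ≟ᶠ c w) λ cu≢cw →
      twoColouredPart⇒¬monochromatic (trans pu (sym pw)) cu≢cw g<q mono

proposition4p7 : (t m k : ℕ) → (c : Fin (suc t * suc m) → Fin k) →
    FAT k (T (suc t) (suc m)) c →
    (g s : ℕ) → g < suc t → s < suc t → g ≢ s →
    Monochromatic (suc t) (suc m) c g ⇔ Monochromatic (suc t) (suc m) c s
proposition4p7 t m k c fat g s g<t s<t _ = mk⇔ (monochromatic-spreads fat g<t) (monochromatic-spreads fat s<t)
  where open CompleteMultipartite (suc t) (suc m)
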